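{- Let $G$ be a graph that has an induced $k$-partite representation in the hypercube. Then the maximum number of edges of a subgraph of $Q_n$ containing no induced copy of $G$ is $o(|E(Q_n)|)$ as $n\to\infty$.
   Context: Identify the vertices of the hypercube $Q_n$ with subsets of $[n]$, two being adjacent iff their symmetric difference has size $1$; the $k$-th vertex layer is $\binom{[n]}{k}$. A down $k$-star is the star consisting of a vertex $X$ of the $k$-th vertex layer together with its $k$ edges to the $(k-1)$-th vertex layer. For a set $A$ of vertices in the $k$-th vertex layer of $Q_n$, $\mathcal H_A$ is the $k$-uniform hypergraph on $[n]$ whose edges are the sets in $A$. A graph $G$ has a (partite) representation if there are integers $k,n$ and a set $A$ of vertices of the $k$-th vertex layer of $Q_n$ such that $\mathcal H_A$ is $k$-partite (its vertex set splits into $k$ parts, each edge meeting every part in exactly one vertex) and $G$ is isomorphic to a subgraph $G'$ of the union of the down $k$-stars centered at the vertices of $A$; the representation is induced if $G'$ is an induced subgraph of $Q_n$. -}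

module Defs where

open import Data.Nat using (ℕ; zero; suc; _+_; _*_; _^_; _≤_)
open import Data.Bool using (Bool; true; false; not; _∧_; if_then_else_)
open import Data.Fin using (Fin)
open import Data.Vec using (Vec; []; _∷_; lookup; updateAt; countᵇ)
open import Data.List using (List; []; _∷_; map; _++_; concatMap; allFin; filterᵇ; length)
open import Data.Product using (Σ; _×_; _,_; ∃; ∃-syntax)
open import Data.Sum using (_⊎_)
open import Relation.Binary.PropositionalEquality using (_≡_)
open import Function.Definitions using (Injective)

record Graph : Set where
  field
    V      : ℕ
    adj    : Fin V → Fin V → Bool
    sym    : ∀ a b → adj a b ≡ adj b a
    irrefl : ∀ a → adj a a ≡ false

-- The hypercube Q_n: vertices are subsets of [n], encoded as
-- characteristic vectors Vec Bool n.

Vertex : ℕ → Set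
Vertex n = Vec Bool n

flipAt : ∀ {n} → Vertex n → Fin n → Vertex n
flipAt x i = updateAt x i not

QAdj : ∀ {n} → Vertex n → Vertex n → Set
QAdj {n} x y = Σ (Fin n) λ i → y ≡ flipAt x i

weight : ∀ {n} → Vertex n → ℕ
weight x = countᵇ (λ b → b) x

allVertices : ∀ n → List (Vertex n)
allVertices zero    = [] ∷ []
allVertices (suc n) = map (false ∷_) (allVertices n) ++ map (true ∷_) (allVertices n)

record SubQ (n : ℕ) : Set where
  field
    vert     : Vertex n → Bool
    edge     : Vertex n → Vertex n → Bool
    edge-sym : ∀ x y → edge x y ≡ edge y x
    edge-adj : ∀ x y → edge x y ≡ true → QAdj x y
    edge-vtx : ∀ x y → edge x y ≡ true → vert x ≡ true

-- number of edges of H: every edge of Q_n is {x, x △ {i}} for a unique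
-- pair (x , i) with i ∉ x; count those pairs whose edge lies in H.
numEdges : ∀ {n} → SubQ n → ℕ
numEdges {n} H =
  length (concatMap
    (λ x → filterᵇ (λ i → not (lookup x i) ∧ SubQ.edge H x (flipAt x i)) (allFin n))
    (allVertices n))

-- H contains an induced copy of G: an injective map of V(G) into V(H)
-- sending edges of G to edges of H, whose image induces in Q_n exactly
-- the image of G (i.e. the copy is an induced subgraph of Q_n).
ContainsInducedCopy : ∀ {n} → Graph → SubQ n → Set
ContainsInducedCopy {n} G H =
  Σ (Fin (Graph.V G) → Vertex n) λ f →
    Injective _≡_ _≡_ f
    × (∀ a → SubQ.vert H (f a) ≡ true)
    × (∀ a b → Graph.adj G a b ≡ true → SubQ.edge H (f a) (f b) ≡ true)
    × (∀ a b → QAdj (f a) (f b) → Graph.adj G a b ≡ true)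

InLayer : ∀ {n} → ℕ → (Vertex n → Bool) → Set
InLayer k A = ∀ X → A X ≡ true → weight X ≡ k

-- the hypergraph H_A is k-partite: a partition of [n] into k parts
-- such that every edge meets every part in exactly one vertex
KPartite : ∀ {n} → ℕ → (Vertex n → Bool) → Set
KPartite {n} k A =
  Σ (Fin n → Fin k) λ part →
    ∀ X → A X ≡ true → ∀ (c : Fin k) →
      (Σ (Fin n) λ j → lookup X j ≡ true × part j ≡ c)
      × (∀ j j' → lookup X j ≡ true → part j ≡ c →
                  lookup X j' ≡ true → part j' ≡ c → j ≡ j')

-- vertices of the union of the down k-stars centred at the vertices of A
StarVertex : ∀ {n} → (Vertex n → Bool) → Vertex n → Set
StarVertex {n} A v =
  A v ≡ true ⊎ (Σ (Vertex n) λ X → Σ (Fin n) λ j → A X ≡ true × lookup X j ≡ true × v ≡ flipAt X j)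

StarEdge : ∀ {n} → (Vertex n → Bool) → Vertex n → Vertex n → Set
StarEdge {n} A u v =
  Σ (Vertex n) λ X → Σ (Fin n) λ j → A X ≡ true × lookup X j ≡ true ×
    ((u ≡ X × v ≡ flipAt X j) ⊎ (v ≡ X × u ≡ flipAt X j))

HasInducedPartiteRep : Graph → Set
HasInducedPartiteRep G =
  Σ ℕ λ k → Σ ℕ λ n → Σ (Vertex n → Bool) λ A →
    InLayer k A × KPartite k A ×
    (Σ (Fin (Graph.V G) → Vertex n) λ φ →
       Injective _≡_ _≡_ φ
       × (∀ a → StarVertex A (φ a))
       × (∀ a b → Graph.adj G a b ≡ true → StarEdge A (φ a) (φ b))
       × (∀ a b → QAdj (φ a) (φ b) → Graph.adj G a b ≡ true))

{-# OPTIONS --safe #-}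

-- Suppose H ⊆ Q_n has more than n 2^n / (2m) edges.  Call a k-tuple a of directions a
-- star below S if the k edges of H going up from S ∖ a in the directions of a are all
-- present.  Double counting and the power-mean inequality give a vertex S below which
-- at least n^k / (2m)^k tuples are stars, and discarding the O(n^(k-1)) tuples with a
-- repeated entry keeps a positive fraction.  Erdős' box theorem for k-partite k-graphs
-- then gives injections c_1, ..., c_k : [n0] → [n] all of whose transversals
-- (c_1 j_1, ..., c_k j_k) are stars below S.  With ι j = c_(part j) j, the map
-- Y ↦ S ∖ ι[Y] embeds Q_n0 as an induced subcube of Q_n that sends the down-star at each
-- X ∈ A onto the up-star at S ∖ ι[X], which is in H; composed with the representation
-- of G this is an induced copy of G in H.

module Submission where

open import Defs
open import Data.Nat using (ℕ; zero; suc; _+_; _*_; _^_; _≤_; _<_; _⊔_; z≤n; s≤s; z<s; _≤?_; NonZero; >-nonZero)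
open import Data.Nat.Properties
open import Data.Nat.Tactic.RingSolver using (solve-∀)
open import Data.Bool using (Bool; true; false; not; _∧_; _∨_)
open import Data.Bool.Properties using (not-injective; not-¬; ¬-not; ⇔→≡; ∧-conicalˡ; ∧-conicalʳ; ∧-identityʳ)
open import Data.Fin using (Fin; zero; suc)
import Data.Fin.Properties as Fin
open import Data.Vec using (Vec; []; _∷_; lookup; tabulate)
import Data.Vec.Properties as Vec
import Data.Vec.Functional as VF
import Data.Vec.Functional.Properties as VF
open import Data.List using (List; []; _∷_; map; _++_; concatMap; allFin; filterᵇ; length)
import Data.List.Properties as List
open import Data.Product using (Σ; _,_; proj₁; proj₂)
open import Data.Sum using (_⊎_; inj₁; inj₂)
open import Data.Empty using (⊥-elim)
open import Function using (_∘_)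
open import Function.Bundles using (mk⇔)
open import Function.Definitions using (Injective)
open import Relation.Binary.PropositionalEquality
open import Relation.Nullary using (¬_; Dec; yes; no; does; contradiction)
open import Relation.Nullary.Decidable using (dec-true)

private variable
  A B : Set

ind : Bool → ℕ
ind true  = 1
ind false = 0

∑ : List A → (A → ℕ) → ℕ
∑ []       f = 0
∑ (x ∷ xs) f = f x + ∑ xs f

syntax ∑ xs (λ x → e) = ∑[ x ∈ xs ] e

∑-++ : ∀ (xs ys : List A) f → ∑ (xs ++ ys) f ≡ ∑ xs f + ∑ ys f
∑-++ []       ys f = refl
∑-++ (x ∷ xs) ys f = trans (cong (f x +_) (∑-++ xs ys f)) (sym (+-assoc (f x) _ _))

∑-cong : ∀ (xs : List A) {f g} → (∀ x → f x ≡ g x) → ∑ xs f ≡ ∑ xs g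
∑-cong []       f≗g = refl
∑-cong (x ∷ xs) f≗g = cong₂ _+_ (f≗g x) (∑-cong xs f≗g)

∑-mono-≤ : ∀ (xs : List A) {f g} → (∀ x → f x ≤ g x) → ∑ xs f ≤ ∑ xs g
∑-mono-≤ []       f≤g = z≤n
∑-mono-≤ (x ∷ xs) f≤g = +-mono-≤ (f≤g x) (∑-mono-≤ xs f≤g)

∑-zero : ∀ (xs : List A) {f} → (∀ x → f x ≡ 0) → ∑ xs f ≡ 0
∑-zero []       f≗0 = refl
∑-zero (x ∷ xs) f≗0 = cong₂ _+_ (f≗0 x) (∑-zero xs f≗0)

∑-const : ∀ (xs : List A) c → ∑[ _ ∈ xs ] c ≡ length xs * c
∑-const []       c = refl
∑-const (x ∷ xs) c = cong (c +_) (∑-const xs c)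

∑-distrib-+ : ∀ (xs : List A) f g → ∑[ x ∈ xs ] (f x + g x) ≡ ∑ xs f + ∑ xs g
∑-distrib-+ []       f g = refl
∑-distrib-+ (x ∷ xs) f g = trans (cong (f x + g x +_) (∑-distrib-+ xs f g)) (+-interchange (f x) _ _ _)
  where
  +-interchange : ∀ a b c d → a + b + (c + d) ≡ a + c + (b + d)
  +-interchange = solve-∀

*-distribˡ-∑ : ∀ (xs : List A) c f → ∑[ x ∈ xs ] (c * f x) ≡ c * ∑ xs f
*-distribˡ-∑ []       c f = sym (*-zeroʳ c)
*-distribˡ-∑ (x ∷ xs) c f = trans (cong (c * f x +_) (*-distribˡ-∑ xs c f)) (sym (*-distribˡ-+ c (f x) _))

*-distribʳ-∑ : ∀ (xs : List A) c f → ∑[ x ∈ xs ] (f x * c) ≡ ∑ xs f * c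
*-distribʳ-∑ xs c f = begin
  ∑[ x ∈ xs ] (f x * c) ≡⟨ ∑-cong xs (λ x → *-comm (f x) c) ⟩
  ∑[ x ∈ xs ] (c * f x) ≡⟨ *-distribˡ-∑ xs c f ⟩
  c * ∑ xs f            ≡⟨ *-comm c _ ⟩
  ∑ xs f * c            ∎
  where open ≡-Reasoning

∑-map : ∀ (g : A → B) xs f → ∑ (map g xs) f ≡ ∑[ x ∈ xs ] f (g x)
∑-map g []       f = refl
∑-map g (x ∷ xs) f = cong (f (g x) +_) (∑-map g xs f)

∑-concatMap : ∀ (g : A → List B) xs f → ∑ (concatMap g xs) f ≡ ∑[ x ∈ xs ] ∑ (g x) f
∑-concatMap g []       f = refl
∑-concatMap g (x ∷ xs) f = trans (∑-++ (g x) _ f) (cong (∑ (g x) f +_) (∑-concatMap g xs f))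

∑-comm : ∀ (xs : List A) (ys : List B) (f : A → B → ℕ) → ∑[ x ∈ xs ] ∑[ y ∈ ys ] f x y ≡ ∑[ y ∈ ys ] ∑[ x ∈ xs ] f x y
∑-comm []       ys f = sym (∑-zero ys (λ _ → refl))
∑-comm (x ∷ xs) ys f = trans (cong (∑ ys (f x) +_) (∑-comm xs ys f)) (sym (∑-distrib-+ ys (f x) _))

∑-product : ∀ (xs : List A) f g → ∑[ x ∈ xs ] ∑[ y ∈ xs ] (f x * g y) ≡ ∑ xs f * ∑ xs g
∑-product xs f g = trans (∑-cong xs (λ x → *-distribˡ-∑ xs (f x) g)) (*-distribʳ-∑ xs _ f)

length-concatMap : ∀ (g : A → List B) xs → length (concatMap g xs) ≡ ∑[ x ∈ xs ] length (g x)
length-concatMap g []       = refl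
length-concatMap g (x ∷ xs) = trans (List.length-++ (g x)) (cong (length (g x) +_) (length-concatMap g xs))

length-filterᵇ : ∀ (p : A → Bool) xs → length (filterᵇ p xs) ≡ ∑[ x ∈ xs ] ind (p x)
length-filterᵇ p []       = refl
length-filterᵇ p (x ∷ xs) with p x
... | true  = cong suc (length-filterᵇ p xs)
... | false = length-filterᵇ p xs

∑>0⇒∃>0 : ∀ (xs : List A) f → 0 < ∑ xs f → Σ A λ x → 0 < f x
∑>0⇒∃>0 (x ∷ xs) f ∑>0 with f x in fx
... | suc _ = x , subst (0 <_) (sym fx) z<s
... | zero  = ∑>0⇒∃>0 xs f ∑>0

pigeonhole : ∀ (xs : List A) f c b → 0 < length xs → length xs * b ≤ c * ∑ xs f →
             Σ A λ x → b ≤ c * f x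
pigeonhole {A = A} xs f c b len>0 avg≥b with termAbove⊎sumBelow xs
  where
  termAbove⊎sumBelow : ∀ xs → (Σ A λ x → b ≤ c * f x) ⊎ (c * ∑ xs f + length xs ≤ length xs * b)
  termAbove⊎sumBelow [] = inj₂ (≤-reflexive (trans (+-identityʳ _) (*-zeroʳ c)))
  termAbove⊎sumBelow (x ∷ xs) with b ≤? c * f x | termAbove⊎sumBelow xs
  ... | yes b≤ | _       = inj₁ (x , b≤)
  ... | no  _  | inj₁ r  = inj₁ r
  ... | no  b≰ | inj₂ r  = inj₂ (begin
    c * (f x + ∑ xs f) + suc (length xs)     ≡⟨ regroup c (f x) (∑ xs f) (length xs) ⟩
    suc (c * f x) + (c * ∑ xs f + length xs) ≤⟨ +-mono-≤ (≰⇒> b≰) r ⟩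
    b + length xs * b                        ∎)
    where
    open ≤-Reasoning
    regroup : ∀ c a s l → c * (a + s) + suc l ≡ suc (c * a) + (c * s + l)
    regroup = solve-∀
... | inj₁ r = r
... | inj₂ r = ⊥-elim (<⇒≱ len>0 (+-cancelˡ-≤ (c * ∑ xs f) _ _ (≤-trans r (≤-trans avg≥b (≤-reflexive (sym (+-identityʳ _)))))))

chebyshev : ∀ (xs : List A) f g → (∀ x y → f x ≤ f y → g x ≤ g y) →
            ∑ xs f * ∑ xs g ≤ length xs * ∑[ x ∈ xs ] (f x * g x)
chebyshev xs f g similarlyOrdered = *-cancelˡ-≤ 2 (begin
  2 * (F * G)                                                     ≡⟨ double-comm F G ⟩
  F * G + G * F                                                   ≡⟨ sym (cong₂ _+_ (∑-product xs f g) (∑-product xs g f)) ⟩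
  ∑[ x ∈ xs ] ∑[ y ∈ xs ] (f x * g y) + ∑[ x ∈ xs ] ∑[ y ∈ xs ] (g x * f y)
                            ≡⟨ cong (∑[ x ∈ xs ] ∑[ y ∈ xs ] (f x * g y) +_) (∑-cong xs (λ x → ∑-cong xs (λ y → *-comm (g x) (f y)))) ⟩
  ∑[ x ∈ xs ] ∑[ y ∈ xs ] (f x * g y) + ∑[ x ∈ xs ] ∑[ y ∈ xs ] (f y * g x)
                            ≡⟨ sym (trans (∑-cong xs (λ x → ∑-distrib-+ xs (λ y → f x * g y) (λ y → f y * g x))) (∑-distrib-+ xs _ _)) ⟩
  ∑[ x ∈ xs ] ∑[ y ∈ xs ] (f x * g y + f y * g x)                 ≤⟨ ∑-mono-≤ xs (λ x → ∑-mono-≤ xs (rearrangement x)) ⟩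
  ∑[ x ∈ xs ] ∑[ y ∈ xs ] (f x * g x + f y * g y)
                            ≡⟨ trans (∑-cong xs (λ x → ∑-distrib-+ xs (λ _ → f x * g x) (λ y → f y * g y))) (∑-distrib-+ xs _ _) ⟩
  ∑[ x ∈ xs ] ∑[ _ ∈ xs ] (f x * g x) + ∑[ _ ∈ xs ] S
                            ≡⟨ cong₂ _+_ (trans (∑-cong xs (λ x → ∑-const xs _)) (*-distribˡ-∑ xs (length xs) (λ x → f x * g x)))
                                         (∑-const xs S) ⟩
  length xs * S + length xs * S                                   ≡⟨ double (length xs * S) ⟩
  2 * (length xs * S)                                             ∎)
  where
  open ≤-Reasoning
  F G S : ℕ
  F = ∑ xs f
  G = ∑ xs g
  S = ∑[ x ∈ xs ] (f x * g x)
  double-comm : ∀ a b → 2 * (a * b) ≡ a * b + b * a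
  double-comm = solve-∀
  double : ∀ a → a + a ≡ 2 * a
  double = solve-∀
  rearrange : ∀ a b c d → a ≤ b → c ≤ d → a * d + b * c ≤ a * c + b * d
  rearrange a b c d a≤b c≤d with m≤n⇒∃[o]m+o≡n a≤b | m≤n⇒∃[o]m+o≡n c≤d
  ... | p , refl | q , refl = begin
    a * (c + q) + (a + p) * c         ≤⟨ m≤m+n _ (p * q) ⟩
    a * (c + q) + (a + p) * c + p * q ≡⟨ expand a c p q ⟩
    a * c + (a + p) * (c + q)         ∎
    where
    expand : ∀ a c p q → a * (c + q) + (a + p) * c + p * q ≡ a * c + (a + p) * (c + q)
    expand = solve-∀

  rearrangement : ∀ x y → f x * g y + f y * g x ≤ f x * g x + f y * g y
  rearrangement x y with ≤-total (f x) (f y)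
  ... | inj₁ fx≤fy = rearrange (f x) (f y) (g x) (g y) fx≤fy (similarlyOrdered x y fx≤fy)
  ... | inj₂ fy≤fx = subst₂ _≤_ (+-comm (f y * g x) (f x * g y)) (+-comm (f y * g y) (f x * g x))
                       (rearrange (f y) (f x) (g y) (g x) fy≤fx (similarlyOrdered y x fy≤fx))

power-mean : ∀ (xs : List A) f t → ∑ xs f ^ suc t ≤ length xs ^ t * ∑[ x ∈ xs ] (f x ^ suc t)
power-mean xs f zero    = ≤-reflexive (begin
  ∑ xs f * 1                       ≡⟨ *-identityʳ _ ⟩
  ∑ xs f                           ≡⟨ ∑-cong xs (λ x → sym (*-identityʳ (f x))) ⟩
  ∑[ x ∈ xs ] (f x * 1)             ≡⟨ sym (*-identityˡ _) ⟩
  1 * ∑[ x ∈ xs ] (f x * 1)         ∎)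
  where open ≡-Reasoning
power-mean xs f (suc t) = begin
  F * F ^ suc t                         ≤⟨ *-monoʳ-≤ F (power-mean xs f t) ⟩
  F * (L ^ t * P)                       ≡⟨ x*[y*z]≡y*[x*z] F (L ^ t) P ⟩
  L ^ t * (F * P)                       ≤⟨ *-monoʳ-≤ (L ^ t) (chebyshev xs f (λ x → f x ^ suc t) (λ _ _ → ^-monoˡ-≤ (suc t))) ⟩
  L ^ t * (L * ∑[ x ∈ xs ] (f x ^ suc (suc t))) ≡⟨ sym (*-assoc (L ^ t) L _) ⟩
  L ^ t * L * ∑[ x ∈ xs ] (f x ^ suc (suc t))   ≡⟨ cong (_* ∑[ x ∈ xs ] (f x ^ suc (suc t))) (*-comm (L ^ t) L) ⟩
  L * L ^ t * ∑[ x ∈ xs ] (f x ^ suc (suc t))   ∎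
  where
  open ≤-Reasoning
  F L P : ℕ
  F = ∑ xs f
  L = length xs
  P = ∑[ x ∈ xs ] (f x ^ suc t)
  x*[y*z]≡y*[x*z] : ∀ a b c → a * (b * c) ≡ b * (a * c)
  x*[y*z]≡y*[x*z] = solve-∀

^-distribʳ-* : ∀ a b e → (a * b) ^ e ≡ a ^ e * b ^ e
^-distribʳ-* a b zero    = refl
^-distribʳ-* a b (suc e) = trans (cong (a * b *_) (^-distribʳ-* a b e)) (interchange a b (a ^ e) (b ^ e))
  where
  interchange : ∀ a b x y → a * b * (x * y) ≡ a * x * (b * y)
  interchange = solve-∀

ind-∧ : ∀ a b → ind (a ∧ b) ≡ ind a * ind b
ind-∧ true  b = sym (+-identityʳ (ind b))
ind-∧ false b = refl

ind≤1 : ∀ b → ind b ≤ 1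
ind≤1 true  = ≤-refl
ind≤1 false = z≤n

ind-∨ : ∀ a b → ind (a ∨ b) ≤ ind a + ind b
ind-∨ true  b = s≤s z≤n
ind-∨ false b = ≤-refl

length-allFin : ∀ n → length (allFin n) ≡ n
length-allFin n = List.length-tabulate {n = n} (λ i → i)

∑-allFin-suc : ∀ n (f : Fin (suc n) → ℕ) → ∑ (allFin (suc n)) f ≡ f zero + ∑[ y ∈ allFin n ] f (suc y)
∑-allFin-suc n f = cong (f zero +_) (trans (cong (λ ys → ∑ ys f) (sym (List.map-tabulate (λ y → y) suc))) (∑-map suc (allFin n) f))

Tuple : ℕ → ℕ → Set
Tuple n k = Vec (Fin n) k

allTuples : ∀ n k → List (Tuple n k)
allTuples n zero    = [] ∷ []
allTuples n (suc k) = concatMap (λ y → map (y ∷_) (allTuples n k)) (allFin n)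

∑-allTuples-suc : ∀ n k (f : Tuple n (suc k) → ℕ) →
                  ∑ (allTuples n (suc k)) f ≡ ∑[ y ∈ allFin n ] ∑[ v ∈ allTuples n k ] f (y ∷ v)
∑-allTuples-suc n k f = trans (∑-concatMap _ (allFin n) f) (∑-cong (allFin n) (λ y → ∑-map (y ∷_) (allTuples n k) f))

length-allTuples : ∀ n k → length (allTuples n k) ≡ n ^ k
length-allTuples n zero    = refl
length-allTuples n (suc k) = begin
  length (allTuples n (suc k))                        ≡⟨ length-concatMap _ (allFin n) ⟩
  ∑[ y ∈ allFin n ] length (map (y ∷_) (allTuples n k)) ≡⟨ ∑-cong (allFin n) (λ y → List.length-map (y ∷_) (allTuples n k)) ⟩
  ∑[ _ ∈ allFin n ] length (allTuples n k)            ≡⟨ ∑-const (allFin n) _ ⟩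
  length (allFin n) * length (allTuples n k)          ≡⟨ cong₂ _*_ (length-allFin n) (length-allTuples n k) ⟩
  n * n ^ k                                           ∎
  where open ≡-Reasoning

count : ∀ {n k} → (Tuple n k → Bool) → ℕ
count {n} {k} D = ∑[ v ∈ allTuples n k ] ind (D v)

allᵇ : ∀ {k} → (A → Bool) → Vec A k → Bool
allᵇ p []      = true
allᵇ p (y ∷ v) = p y ∧ allᵇ p v

allᵇ⇒lookup : ∀ {k} (p : A → Bool) (v : Vec A k) → allᵇ p v ≡ true → ∀ i → p (lookup v i) ≡ true
allᵇ⇒lookup p (y ∷ v) all zero    = ∧-conicalˡ (p y) _ all
allᵇ⇒lookup p (y ∷ v) all (suc i) = allᵇ⇒lookup p v (∧-conicalʳ (p y) _ all) i

count-allᵇ : ∀ n k (p : Fin n → Bool) → count {n} {k} (allᵇ p) ≡ (∑[ y ∈ allFin n ] ind (p y)) ^ k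
count-allᵇ n zero    p = refl
count-allᵇ n (suc k) p = begin
  count {n} {suc k} (allᵇ p)                                     ≡⟨ ∑-allTuples-suc n k _ ⟩
  ∑[ y ∈ allFin n ] ∑[ v ∈ allTuples n k ] ind (p y ∧ allᵇ p v)
                                         ≡⟨ ∑-cong (allFin n) (λ y → ∑-cong (allTuples n k) (λ v → ind-∧ (p y) _)) ⟩
  ∑[ y ∈ allFin n ] ∑[ v ∈ allTuples n k ] (ind (p y) * ind (allᵇ p v))
                                         ≡⟨ ∑-cong (allFin n) (λ y → *-distribˡ-∑ (allTuples n k) (ind (p y)) _) ⟩
  ∑[ y ∈ allFin n ] (ind (p y) * count {n} {k} (allᵇ p))         ≡⟨ *-distribʳ-∑ (allFin n) _ _ ⟩
  ∑[ y ∈ allFin n ] ind (p y) * count {n} {k} (allᵇ p)           ≡⟨ cong (∑[ y ∈ allFin n ] ind (p y) *_) (count-allᵇ n k p) ⟩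
  (∑[ y ∈ allFin n ] ind (p y)) ^ suc k                          ∎
  where open ≡-Reasoning

degree : ∀ {n} → (B → Fin n → Bool) → B → ℕ
degree {n = n} R b = ∑[ y ∈ allFin n ] ind (R b y)

_∈ᵇ_ : ∀ {n k} → Fin n → Tuple n k → Bool
y ∈ᵇ []      = false
y ∈ᵇ (z ∷ v) = does (y Fin.≟ z) ∨ y ∈ᵇ v

∈ᵇ⇒∃lookup : ∀ {n k} (y : Fin n) (v : Tuple n k) → y ∈ᵇ v ≡ true → Σ (Fin k) λ i → lookup v i ≡ y
∈ᵇ⇒∃lookup y (z ∷ v) y∈v with y Fin.≟ z
... | yes y≡z = zero , sym y≡z
... | no  _   with ∈ᵇ⇒∃lookup y v y∈v
...   | i , vᵢ≡y = suc i , vᵢ≡y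

lookup∈ᵇ : ∀ {n k} (v : Tuple n k) i → lookup v i ∈ᵇ v ≡ true
lookup∈ᵇ (z ∷ v) zero    rewrite dec-true (z Fin.≟ z) refl = refl
lookup∈ᵇ (z ∷ v) (suc i) with lookup v i Fin.≟ z
... | yes _ = refl
... | no  _ = lookup∈ᵇ v i

distinct : ∀ {n k} → Tuple n k → Bool
distinct []      = true
distinct (y ∷ v) = not (y ∈ᵇ v) ∧ distinct v

head∉ᵇtail : ∀ {n k} (y : Fin n) (v : Tuple n k) → distinct (y ∷ v) ≡ true → y ∈ᵇ v ≡ false
head∉ᵇtail y v dist with y ∈ᵇ v | dist
... | false | _ = refl

distinct⇒lookup-injective : ∀ {n k} (v : Tuple n k) → distinct v ≡ true → Injective _≡_ _≡_ (lookup v)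
distinct⇒lookup-injective (y ∷ v) dist {zero}  {zero}  _ = refl
distinct⇒lookup-injective (y ∷ v) dist {zero}  {suc j} y≡vⱼ =
  contradiction (trans (sym (subst (λ z → z ∈ᵇ v ≡ true) (sym y≡vⱼ) (lookup∈ᵇ v j))) (head∉ᵇtail y v dist)) λ ()
distinct⇒lookup-injective (y ∷ v) dist {suc i} {zero}  vᵢ≡y =
  contradiction (trans (sym (subst (λ z → z ∈ᵇ v ≡ true) vᵢ≡y (lookup∈ᵇ v i))) (head∉ᵇtail y v dist)) λ ()
distinct⇒lookup-injective (y ∷ v) dist {suc i} {suc j} vᵢ≡vⱼ =
  cong suc (distinct⇒lookup-injective v (∧-conicalʳ _ _ dist) vᵢ≡vⱼ)

count-≟ : ∀ n (z : Fin n) → ∑[ y ∈ allFin n ] ind (does (y Fin.≟ z)) ≡ 1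
count-≟ (suc n) z = trans (∑-allFin-suc n (λ y → ind (does (y Fin.≟ z)))) (count-≟-suc z)
  where
  count-≟-suc : ∀ z → ind (does (zero Fin.≟ z)) + ∑[ y ∈ allFin n ] ind (does (suc y Fin.≟ z)) ≡ 1
  count-≟-suc zero    = cong suc (∑-zero (allFin n) (λ _ → refl))
  count-≟-suc (suc z) = count-≟ n z

count-∈ᵇ : ∀ n {k} (v : Tuple n k) → ∑[ y ∈ allFin n ] ind (y ∈ᵇ v) ≤ k
count-∈ᵇ n []      = ≤-reflexive (∑-zero (allFin n) (λ _ → refl))
count-∈ᵇ n (z ∷ v) = begin
  ∑[ y ∈ allFin n ] ind (does (y Fin.≟ z) ∨ y ∈ᵇ v)            ≤⟨ ∑-mono-≤ (allFin n) (λ y → ind-∨ (does (y Fin.≟ z)) _) ⟩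
  ∑[ y ∈ allFin n ] (ind (does (y Fin.≟ z)) + ind (y ∈ᵇ v))     ≡⟨ ∑-distrib-+ (allFin n) _ _ ⟩
  ∑[ y ∈ allFin n ] ind (does (y Fin.≟ z)) + ∑[ y ∈ allFin n ] ind (y ∈ᵇ v)
                                                    ≤⟨ +-mono-≤ (≤-reflexive (count-≟ n z)) (count-∈ᵇ n v) ⟩
  suc _                                                        ∎
  where open ≤-Reasoning

nonDistinct : ℕ → ℕ → ℕ
nonDistinct n k = count {n} {k} (λ v → not (distinct v))

nonDistinct-suc : ∀ n k → nonDistinct n (suc k) ≤ n ^ k * k + n * nonDistinct n k
nonDistinct-suc n k = begin
  nonDistinct n (suc k)                                                         ≡⟨ ∑-allTuples-suc n k _ ⟩
  ∑[ y ∈ allFin n ] ∑[ v ∈ allTuples n k ] ind (not (not (y ∈ᵇ v) ∧ distinct v))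
                          ≤⟨ ∑-mono-≤ (allFin n) (λ y → ∑-mono-≤ (allTuples n k) (λ v → repeat∨nonDistinct (y ∈ᵇ v) (distinct v))) ⟩
  ∑[ y ∈ allFin n ] ∑[ v ∈ allTuples n k ] (ind (y ∈ᵇ v) + ind (not (distinct v)))
                          ≡⟨ trans (∑-cong (allFin n) (λ y → ∑-distrib-+ (allTuples n k) _ _)) (∑-distrib-+ (allFin n) _ _) ⟩
  ∑[ y ∈ allFin n ] ∑[ v ∈ allTuples n k ] ind (y ∈ᵇ v) + ∑[ _ ∈ allFin n ] nonDistinct n k
                          ≡⟨ cong₂ _+_ (∑-comm (allFin n) (allTuples n k) _)
                                       (trans (∑-const (allFin n) _) (cong (_* nonDistinct n k) (length-allFin n))) ⟩
  ∑[ v ∈ allTuples n k ] ∑[ y ∈ allFin n ] ind (y ∈ᵇ v) + n * nonDistinct n k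
                          ≤⟨ +-monoˡ-≤ _ (∑-mono-≤ (allTuples n k) (count-∈ᵇ n)) ⟩
  ∑[ _ ∈ allTuples n k ] k + n * nonDistinct n k
                          ≡⟨ cong (_+ n * nonDistinct n k) (trans (∑-const (allTuples n k) k) (cong (_* k) (length-allTuples n k))) ⟩
  n ^ k * k + n * nonDistinct n k                                               ∎
  where
  open ≤-Reasoning
  repeat∨nonDistinct : ∀ a b → ind (not (not a ∧ b)) ≤ ind a + ind (not b)
  repeat∨nonDistinct true  b     = s≤s z≤n
  repeat∨nonDistinct false true  = z≤n
  repeat∨nonDistinct false false = ≤-refl

nonDistinct-bound : ∀ n k → n * nonDistinct n k ≤ k * k * n ^ k
nonDistinct-bound n zero    = ≤-reflexive (*-zeroʳ n)
nonDistinct-bound n (suc k) = begin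
  n * nonDistinct n (suc k)                     ≤⟨ *-monoʳ-≤ n (nonDistinct-suc n k) ⟩
  n * (n ^ k * k + n * nonDistinct n k)         ≡⟨ *-distribˡ-+ n _ _ ⟩
  n * (n ^ k * k) + n * (n * nonDistinct n k)   ≤⟨ +-monoʳ-≤ (n * (n ^ k * k)) (*-monoʳ-≤ n (nonDistinct-bound n k)) ⟩
  n * (n ^ k * k) + n * (k * k * n ^ k)         ≡⟨ collect n k (n ^ k) ⟩
  (k * k + k) * (n * n ^ k)                     ≤⟨ *-monoˡ-≤ (n * n ^ k) (k*k+k≤[1+k]*[1+k] k) ⟩
  suc k * suc k * n ^ suc k                     ∎
  where
  open ≤-Reasoning
  collect : ∀ n k p → n * (p * k) + n * (k * k * p) ≡ (k * k + k) * (n * p)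
  collect = solve-∀
  k*k+k≤[1+k]*[1+k] : ∀ k → k * k + k ≤ suc k * suc k
  k*k+k≤[1+k]*[1+k] k = ≤-trans (m≤m+n (k * k + k) (suc k)) (≤-reflexive (square k))
    where
    square : ∀ k → k * k + k + suc k ≡ suc k * suc k
    square = solve-∀

absorb-error : ∀ n x M s d K → 0 < n → 2 * M * K ≤ n → x ≤ M * (s + d) → n * d ≤ K * x → x ≤ 2 * M * s
absorb-error n x M s d K n>0 2MK≤n x≤M[s+d] nd≤Kx = *-cancelˡ-≤ n {{>-nonZero n>0}} (+-cancelʳ-≤ (n * x) _ _ (begin
  n * x + n * x                     ≡⟨ double (n * x) ⟩
  2 * (n * x)                       ≤⟨ *-monoʳ-≤ 2 (*-monoʳ-≤ n x≤M[s+d]) ⟩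
  2 * (n * (M * (s + d)))           ≡⟨ expand n M s d ⟩
  n * (2 * M * s) + M * 2 * (n * d) ≤⟨ +-monoʳ-≤ (n * (2 * M * s)) (*-monoʳ-≤ (M * 2) nd≤Kx) ⟩
  n * (2 * M * s) + M * 2 * (K * x) ≡⟨ cong (n * (2 * M * s) +_) (regroup M K x) ⟩
  n * (2 * M * s) + 2 * M * K * x   ≤⟨ +-monoʳ-≤ (n * (2 * M * s)) (*-monoˡ-≤ x 2MK≤n) ⟩
  n * (2 * M * s) + n * x           ∎))
  where
  open ≤-Reasoning
  double : ∀ a → a + a ≡ 2 * a
  double = solve-∀
  expand : ∀ n M s d → 2 * (n * (M * (s + d))) ≡ n * (2 * M * s) + M * 2 * (n * d)
  expand = solve-∀
  regroup : ∀ M K x → M * 2 * (K * x) ≡ 2 * M * K * x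
  regroup = solve-∀

∑-split-distinct : ∀ n k b (F : Tuple n k → ℕ) → (∀ v → F v ≤ b) →
                   ∑ (allTuples n k) F ≤ ∑[ v ∈ allTuples n k ] (ind (distinct v) * F v) + nonDistinct n k * b
∑-split-distinct n k b F F≤b = begin
  ∑ (allTuples n k) F                                                                ≤⟨ ∑-mono-≤ (allTuples n k) split ⟩
  ∑[ v ∈ allTuples n k ] (ind (distinct v) * F v + ind (not (distinct v)) * b)       ≡⟨ ∑-distrib-+ (allTuples n k) _ _ ⟩
  ∑[ v ∈ allTuples n k ] (ind (distinct v) * F v) + ∑[ v ∈ allTuples n k ] (ind (not (distinct v)) * b)
                                                           ≡⟨ cong (_ +_) (*-distribʳ-∑ (allTuples n k) b _) ⟩
  ∑[ v ∈ allTuples n k ] (ind (distinct v) * F v) + nonDistinct n k * b              ∎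
  where
  open ≤-Reasoning
  split : ∀ v → F v ≤ ind (distinct v) * F v + ind (not (distinct v)) * b
  split v with distinct v
  ... | true  = ≤-reflexive (sym (trans (+-identityʳ _) (+-identityʳ _)))
  ... | false = ≤-trans (F≤b v) (≤-reflexive (sym (+-identityʳ b)))

mostly-distinct : ∀ {n k} M b (F : Tuple n k → ℕ) → 2 * M * (k * k) < n → (∀ v → F v ≤ b) →
                  n ^ k * b ≤ M * ∑ (allTuples n k) F →
                  n ^ k * b ≤ 2 * M * ∑[ v ∈ allTuples n k ] (ind (distinct v) * F v)
mostly-distinct {n} {k} M b F 2Mk²<n F≤b dense =
  absorb-error n (n ^ k * b) M _ (nonDistinct n k * b) (k * k) (≤-trans (s≤s z≤n) 2Mk²<n) (<⇒≤ 2Mk²<n)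
    (≤-trans dense (*-monoʳ-≤ M (∑-split-distinct n k b F F≤b)))
    (begin
      n * (nonDistinct n k * b) ≡⟨ sym (*-assoc n _ b) ⟩
      n * nonDistinct n k * b   ≤⟨ *-monoˡ-≤ b (nonDistinct-bound n k) ⟩
      k * k * n ^ k * b         ≡⟨ *-assoc (k * k) _ b ⟩
      k * k * (n ^ k * b)       ∎)
  where open ≤-Reasoning

count-distinct : ∀ {n k} M (D : Tuple n k → Bool) → 2 * M * (k * k) < n → n ^ k ≤ M * count D →
                 n ^ k ≤ 2 * M * count (λ v → distinct v ∧ D v)
count-distinct {n} {k} M D 2Mk²<n dense = begin
  n ^ k                                                   ≡⟨ sym (*-identityʳ _) ⟩
  n ^ k * 1                                               ≤⟨ mostly-distinct M 1 (ind ∘ D) 2Mk²<n (λ v → ind≤1 (D v))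
                                                               (subst (_≤ M * count D) (sym (*-identityʳ (n ^ k))) dense) ⟩
  2 * M * ∑[ v ∈ allTuples n k ] (ind (distinct v) * ind (D v))
                                    ≡⟨ cong (2 * M *_) (∑-cong (allTuples n k) (λ v → sym (ind-∧ (distinct v) (D v)))) ⟩
  2 * M * count (λ v → distinct v ∧ D v)                  ∎
  where open ≤-Reasoning

count≤n^k : ∀ {n k} (D : Tuple n k → Bool) → count D ≤ n ^ k
count≤n^k {n} {k} D = begin
  count D                       ≤⟨ ∑-mono-≤ (allTuples n k) (λ v → ind≤1 (D v)) ⟩
  ∑[ _ ∈ allTuples n k ] 1      ≡⟨ ∑-const (allTuples n k) 1 ⟩
  length (allTuples n k) * 1    ≡⟨ cong (_* 1) (length-allTuples n k) ⟩
  n ^ k * 1                     ≡⟨ *-identityʳ _ ⟩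
  n ^ k                         ∎
  where open ≤-Reasoning

record Box {n k} (t : ℕ) (D : Tuple n k → Bool) : Set where
  field
    side           : Fin k → Fin t → Fin n
    side-injective : ∀ i → Injective _≡_ _≡_ (side i)
    corner∈D       : ∀ (s : Fin k → Fin t) → D (tabulate λ i → side i (s i)) ≡ true

Box-shrink : ∀ {n k t} {D : Tuple n k → Bool} → Box (suc t) D → Box t D
Box-shrink box = record
  { side           = λ i u → side i (suc u)
  ; side-injective = λ i eq → Fin.suc-injective (side-injective i eq)
  ; corner∈D       = λ s → corner∈D (suc ∘ s)
  }
  where open Box box

common : ∀ {n k t} → (Tuple n (suc k) → Bool) → Tuple n t → Tuple n k → Bool
common D ȳ r = allᵇ (λ y → D (y ∷ r)) ȳ

Box-cons : ∀ {n k t} (D : Tuple n (suc k) → Bool) (ȳ : Tuple n t) →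
           distinct ȳ ≡ true → Box t (common D ȳ) → Box t D
Box-cons D ȳ ȳ-distinct box = record
  { side           = λ { zero → lookup ȳ ; (suc i) → side i }
  ; side-injective = λ { zero → distinct⇒lookup-injective ȳ ȳ-distinct ; (suc i) → side-injective i }
  ; corner∈D       = λ s → allᵇ⇒lookup _ ȳ (corner∈D (s ∘ suc)) (s zero)
  }
  where open Box box

many-stars : ∀ {n} (xs : List B) (R : B → Fin n → Bool) t a M → 0 < length xs →
             a * length xs ≤ M * ∑ xs (degree R) →
             a ^ suc t * length xs ≤ M ^ suc t * ∑[ ȳ ∈ allTuples n (suc t) ] ∑[ b ∈ xs ] ind (allᵇ (R b) ȳ)
many-stars {n = n} xs R t a M L>0 dense = *-cancelʳ-≤ _ _ (L ^ t) {{m^n≢0 L t {{>-nonZero L>0}}}} (begin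
  a ^ suc t * L * L ^ t                    ≡⟨ regroup (a ^ suc t) L (L ^ t) ⟩
  a ^ suc t * L ^ suc t                    ≡⟨ sym (^-distribʳ-* a L (suc t)) ⟩
  (a * L) ^ suc t                          ≤⟨ ^-monoˡ-≤ (suc t) dense ⟩
  (M * ∑ xs (degree R)) ^ suc t            ≡⟨ ^-distribʳ-* M _ (suc t) ⟩
  M ^ suc t * (∑ xs (degree R)) ^ suc t    ≤⟨ *-monoʳ-≤ (M ^ suc t) (power-mean xs (degree R) t) ⟩
  M ^ suc t * (L ^ t * ∑[ b ∈ xs ] (degree R b ^ suc t))
                                           ≡⟨ cong (λ s → M ^ suc t * (L ^ t * s)) ∑degree^≡∑stars ⟩
  M ^ suc t * (L ^ t * stars)              ≡⟨ swap (M ^ suc t) (L ^ t) stars ⟩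
  M ^ suc t * stars * L ^ t                ∎)
  where
  open ≤-Reasoning
  L stars : ℕ
  L = length xs
  stars = ∑[ ȳ ∈ allTuples n (suc t) ] ∑[ b ∈ xs ] ind (allᵇ (R b) ȳ)
  ∑degree^≡∑stars : ∑[ b ∈ xs ] (degree R b ^ suc t) ≡ stars
  ∑degree^≡∑stars = trans (∑-cong xs (λ b → sym (count-allᵇ n (suc t) (R b)))) (∑-comm xs (allTuples n (suc t)) _)
  regroup : ∀ a b c → a * b * c ≡ a * (b * c)
  regroup = solve-∀
  swap : ∀ a b c → a * (b * c) ≡ a * c * b
  swap = solve-∀

many-common-rows : ∀ {n k} t M (D : Tuple n (suc k) → Bool) → 0 < n → n ^ suc k ≤ M * count D →
                   n ^ suc t * n ^ k ≤ M ^ suc t * ∑[ ȳ ∈ allTuples n (suc t) ] count (common D ȳ)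
many-common-rows {n} {k} t M D n>0 dense =
  subst (λ L → n ^ suc t * L ≤ M ^ suc t * ∑[ ȳ ∈ allTuples n (suc t) ] count (common D ȳ)) (length-allTuples n k)
    (many-stars (allTuples n k) (λ r y → D (y ∷ r)) t n M
      (subst (0 <_) (sym (length-allTuples n k)) (m^n>0 n {{>-nonZero n>0}} k))
      (subst₂ (λ L c → n * L ≤ M * c) (sym (length-allTuples n k)) count≡∑degree dense))
  where
  count≡∑degree : count D ≡ ∑ (allTuples n k) (degree (λ r y → D (y ∷ r)))
  count≡∑degree = trans (∑-allTuples-suc n k _) (∑-comm (allFin n) (allTuples n k) _)

-- Induction on k: many-common-rows and pigeonhole give a tuple ȳ of distinct first
-- coordinates with many common rows, and a box among those rows extends by ȳ.
dense⇒box : ∀ k t M → Σ ℕ λ N → ∀ n → N ≤ n → (D : Tuple n k → Bool) → n ^ k ≤ M * count D → Box (suc t) D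
dense⇒box zero    t M = 0 , λ n _ D dense → record
  { side = λ () ; side-injective = λ () ; corner∈D = λ _ → []∈D D dense }
  where
  []∈D : ∀ {n} (D : Tuple n 0 → Bool) → 1 ≤ M * (ind (D []) + 0) → D [] ≡ true
  []∈D D dense with D []
  ... | true  = refl
  ... | false = contradiction (≤-trans dense (≤-reflexive (*-zeroʳ M))) λ ()
dense⇒box (suc k) t M = N , box
  where
  Z N : ℕ
  Z = M ^ suc t
  N = proj₁ (dense⇒box k t (2 * Z)) ⊔ suc (2 * Z * (suc t * suc t))
  box : ∀ n → N ≤ n → (D : Tuple n (suc k) → Bool) → n ^ suc k ≤ M * count D → Box (suc t) D
  box n N≤n D dense = heaviest (pigeonhole ȳs mass (2 * Z) (n ^ k)
                                 (subst (0 <_) (sym (length-allTuples n (suc t))) (m^n>0 n (suc t)))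
                                 (subst (λ l → l * n ^ k ≤ 2 * Z * ∑ ȳs mass) (sym (length-allTuples n (suc t))) distinctRowsDense))
    where
    ȳs : List (Tuple n (suc t))
    ȳs = allTuples n (suc t)
    mass : Tuple n (suc t) → ℕ
    mass ȳ = ind (distinct ȳ) * count (common D ȳ)
    2Zt²<n : 2 * Z * (suc t * suc t) < n
    2Zt²<n = ≤-trans (m≤n⊔m _ _) N≤n
    n>0 : 0 < n
    n>0 = ≤-trans (s≤s z≤n) 2Zt²<n
    instance
      n≢0 : NonZero n
      n≢0 = >-nonZero n>0
    distinctRowsDense : n ^ suc t * n ^ k ≤ 2 * Z * ∑ ȳs mass
    distinctRowsDense = mostly-distinct Z (n ^ k) (λ ȳ → count (common D ȳ)) 2Zt²<n (λ ȳ → count≤n^k (common D ȳ))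
                          (many-common-rows t M D n>0 dense)
    heaviest : (Σ (Tuple n (suc t)) λ ȳ → n ^ k ≤ 2 * Z * mass ȳ) → Box (suc t) D
    heaviest (ȳ , heavy) with distinct ȳ in ȳ-distinct
    ... | true  = Box-cons D ȳ ȳ-distinct (proj₂ (dense⇒box k t (2 * Z)) n (≤-trans (m≤m⊔n _ _) N≤n) (common D ȳ)
                    (subst (λ c → n ^ k ≤ 2 * Z * c) (+-identityʳ _) heavy))
    ... | false = contradiction (≤-trans heavy (≤-reflexive (*-zeroʳ (2 * Z)))) (<⇒≱ (m^n>0 n k))

∑-allVertices-suc : ∀ n (f : Vertex (suc n) → ℕ) →
                    ∑ (allVertices (suc n)) f ≡ ∑[ x ∈ allVertices n ] f (false ∷ x) + ∑[ x ∈ allVertices n ] f (true ∷ x)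
∑-allVertices-suc n f = trans (∑-++ (map (false ∷_) (allVertices n)) _ f)
                              (cong₂ _+_ (∑-map (false ∷_) (allVertices n) f) (∑-map (true ∷_) (allVertices n) f))

length-allVertices : ∀ n → length (allVertices n) ≡ 2 ^ n
length-allVertices zero    = refl
length-allVertices (suc n) = begin
  length (map (false ∷_) (allVertices n) ++ map (true ∷_) (allVertices n)) ≡⟨ List.length-++ (map (false ∷_) (allVertices n)) ⟩
  length (map (false ∷_) (allVertices n)) + length (map (true ∷_) (allVertices n))
                                   ≡⟨ cong₂ _+_ (List.length-map (false ∷_) (allVertices n)) (List.length-map (true ∷_) (allVertices n)) ⟩
  length (allVertices n) + length (allVertices n) ≡⟨ cong₂ _+_ (length-allVertices n) (trans (length-allVertices n) (sym (+-identityʳ _))) ⟩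
  2 ^ n + (2 ^ n + 0)                             ∎
  where open ≡-Reasoning

_⊆ᵇ_ : ∀ {n} → Vertex n → Vertex n → Bool
[]      ⊆ᵇ []      = true
(m ∷ M) ⊆ᵇ (s ∷ S) = (not m ∨ s) ∧ M ⊆ᵇ S

_∖_ : ∀ {n} → Vertex n → Vertex n → Vertex n
[]      ∖ []      = []
(s ∷ S) ∖ (m ∷ M) = (s ∧ not m) ∷ (S ∖ M)

disjointᵇ : ∀ {n} → Vertex n → Vertex n → Bool
disjointᵇ []      []      = true
disjointᵇ (m ∷ M) (x ∷ X) = not (m ∧ x) ∧ disjointᵇ M X

∑-supersets≡∑-disjoint : ∀ n (M : Vertex n) (h : Vertex n → ℕ) →
  ∑[ S ∈ allVertices n ] (ind (M ⊆ᵇ S) * h (S ∖ M)) ≡ ∑[ x ∈ allVertices n ] (ind (disjointᵇ M x) * h x)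
∑-supersets≡∑-disjoint zero    []      h = refl
∑-supersets≡∑-disjoint (suc n) (true ∷ M) h = begin
  ∑[ S ∈ allVertices (suc n) ] (ind ((true ∷ M) ⊆ᵇ S) * h (S ∖ (true ∷ M)))   ≡⟨ ∑-allVertices-suc n _ ⟩
  ∑[ _ ∈ Vs ] 0 + ∑[ S ∈ Vs ] (ind (M ⊆ᵇ S) * h (false ∷ (S ∖ M)))
                                  ≡⟨ cong₂ _+_ ∑0≡0 (∑-supersets≡∑-disjoint n M (h ∘ (false ∷_))) ⟩
  ∑[ x ∈ Vs ] (ind (disjointᵇ M x) * h (false ∷ x))                          ≡⟨ sym (+-identityʳ _) ⟩
  ∑[ x ∈ Vs ] (ind (disjointᵇ M x) * h (false ∷ x)) + 0
                                  ≡⟨ cong (∑[ x ∈ Vs ] (ind (disjointᵇ M x) * h (false ∷ x)) +_) (sym ∑0≡0) ⟩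
  ∑[ x ∈ Vs ] (ind (disjointᵇ M x) * h (false ∷ x)) + ∑[ _ ∈ Vs ] 0          ≡⟨ sym (∑-allVertices-suc n _) ⟩
  ∑[ x ∈ allVertices (suc n) ] (ind (disjointᵇ (true ∷ M) x) * h x)          ∎
  where
  open ≡-Reasoning
  Vs : List (Vertex n)
  Vs = allVertices n
  ∑0≡0 : ∑[ _ ∈ Vs ] 0 ≡ 0
  ∑0≡0 = ∑-zero Vs (λ _ → refl)
∑-supersets≡∑-disjoint (suc n) (false ∷ M) h = begin
  ∑[ S ∈ allVertices (suc n) ] (ind ((false ∷ M) ⊆ᵇ S) * h (S ∖ (false ∷ M)))   ≡⟨ ∑-allVertices-suc n _ ⟩
  ∑[ S ∈ allVertices n ] (ind (M ⊆ᵇ S) * h (false ∷ (S ∖ M))) + ∑[ S ∈ allVertices n ] (ind (M ⊆ᵇ S) * h (true ∷ (S ∖ M)))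
                                   ≡⟨ cong₂ _+_ (∑-supersets≡∑-disjoint n M (h ∘ (false ∷_)))
                                                (∑-supersets≡∑-disjoint n M (h ∘ (true ∷_))) ⟩
  ∑[ x ∈ allVertices n ] (ind (disjointᵇ M x) * h (false ∷ x)) + ∑[ x ∈ allVertices n ] (ind (disjointᵇ M x) * h (true ∷ x))
                                   ≡⟨ sym (∑-allVertices-suc n _) ⟩
  ∑[ x ∈ allVertices (suc n) ] (ind (disjointᵇ (false ∷ M) x) * h x)            ∎
  where open ≡-Reasoning

lookup-∖ : ∀ {n} (S M : Vertex n) p → lookup (S ∖ M) p ≡ lookup S p ∧ not (lookup M p)
lookup-∖ (s ∷ S) (m ∷ M) zero    = refl
lookup-∖ (s ∷ S) (m ∷ M) (suc p) = lookup-∖ S M p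

⊆ᵇ⇒lookup : ∀ {n} (M S : Vertex n) → M ⊆ᵇ S ≡ true → ∀ p → lookup M p ≡ true → lookup S p ≡ true
⊆ᵇ⇒lookup (true ∷ M) (true ∷ S) M⊆S zero    _   = refl
⊆ᵇ⇒lookup (m ∷ M)    (s ∷ S)    M⊆S (suc p) Mₚ = ⊆ᵇ⇒lookup M S (∧-conicalʳ (not m ∨ s) _ M⊆S) p Mₚ

disjointᵇ-intro : ∀ {n} (M x : Vertex n) → (∀ p → lookup M p ≡ true → lookup x p ≡ false) → disjointᵇ M x ≡ true
disjointᵇ-intro []         []      _        = refl
disjointᵇ-intro (true ∷ M) (x ∷ X) M∩x≡∅ rewrite M∩x≡∅ zero refl = disjointᵇ-intro M X (M∩x≡∅ ∘ suc)
disjointᵇ-intro (false ∷ M) (x ∷ X) M∩x≡∅ = disjointᵇ-intro M X (M∩x≡∅ ∘ suc)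

setOf : ∀ {n k} → Tuple n k → Vertex n
setOf a = tabulate (_∈ᵇ a)

module _ {n : ℕ} (H : SubQ n) where

  upEdge : Vertex n → Fin n → Bool
  upEdge x i = not (lookup x i) ∧ SubQ.edge H x (flipAt x i)

  numEdges≡∑degree : numEdges H ≡ ∑ (allVertices n) (degree upEdge)
  numEdges≡∑degree = trans (length-concatMap _ (allVertices n)) (∑-cong (allVertices n) (λ x → length-filterᵇ _ (allFin n)))

  StarBelow : ∀ {k} → Vertex n → Tuple n k → Bool
  StarBelow S a = setOf a ⊆ᵇ S ∧ allᵇ (upEdge (S ∖ setOf a)) a

  ∑-count-StarBelow : ∀ k → ∑[ S ∈ allVertices n ] count {n} {k} (StarBelow S) ≡
                            ∑[ a ∈ allTuples n k ] ∑[ x ∈ allVertices n ] ind (allᵇ (upEdge x) a)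
  ∑-count-StarBelow k = begin
    ∑[ S ∈ Vs ] ∑[ a ∈ As ] ind (StarBelow S a)                              ≡⟨ ∑-comm Vs As _ ⟩
    ∑[ a ∈ As ] ∑[ S ∈ Vs ] ind (StarBelow S a)
                  ≡⟨ ∑-cong As (λ a → ∑-cong Vs (λ S → ind-∧ (setOf a ⊆ᵇ S) _)) ⟩
    ∑[ a ∈ As ] ∑[ S ∈ Vs ] (ind (setOf a ⊆ᵇ S) * ind (allᵇ (upEdge (S ∖ setOf a)) a))
                  ≡⟨ ∑-cong As (λ a → ∑-supersets≡∑-disjoint n (setOf a) (λ x → ind (allᵇ (upEdge x) a))) ⟩
    ∑[ a ∈ As ] ∑[ x ∈ Vs ] (ind (disjointᵇ (setOf a) x) * ind (allᵇ (upEdge x) a))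
                  ≡⟨ ∑-cong As (λ a → ∑-cong Vs (upStar-disjoint a)) ⟩
    ∑[ a ∈ As ] ∑[ x ∈ Vs ] ind (allᵇ (upEdge x) a)                          ∎
    where
    open ≡-Reasoning
    Vs : List (Vertex n)
    Vs = allVertices n
    As : List (Tuple n k)
    As = allTuples n k
    upStar-disjoint : ∀ a x → ind (disjointᵇ (setOf a) x) * ind (allᵇ (upEdge x) a) ≡ ind (allᵇ (upEdge x) a)
    upStar-disjoint a x with allᵇ (upEdge x) a in upStar
    ... | false = *-zeroʳ (ind (disjointᵇ (setOf a) x))
    ... | true  = cong (λ b → ind b * 1) (disjointᵇ-intro (setOf a) x outside)
      where
      outside : ∀ p → lookup (setOf a) p ≡ true → lookup x p ≡ false
      outside p p∈a with ∈ᵇ⇒∃lookup p a (trans (sym (Vec.lookup∘tabulate _ p)) p∈a)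
      ... | i , refl with lookup x (lookup a i) | allᵇ⇒lookup (upEdge x) a upStar i
      ...   | false | _ = refl

  many-edges⇒dense-stars : ∀ t m → n * 2 ^ n < 2 * m * numEdges H →
                           Σ (Vertex n) λ S → n ^ suc t ≤ (2 * m) ^ suc t * count {n} {suc t} (StarBelow S)
  many-edges⇒dense-stars t m many = pigeonhole Vs (λ S → count {n} {suc t} (StarBelow S)) ((2 * m) ^ suc t) (n ^ suc t) Vs≢[]
    (begin
      length Vs * n ^ suc t                               ≡⟨ *-comm (length Vs) _ ⟩
      n ^ suc t * length Vs                               ≤⟨ many-stars Vs upEdge t n (2 * m) Vs≢[] edgesDense ⟩
      (2 * m) ^ suc t * ∑[ a ∈ allTuples n (suc t) ] ∑[ x ∈ Vs ] ind (allᵇ (upEdge x) a)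
                                                          ≡⟨ cong ((2 * m) ^ suc t *_) (sym (∑-count-StarBelow (suc t))) ⟩
      (2 * m) ^ suc t * ∑[ S ∈ Vs ] count {n} {suc t} (StarBelow S)   ∎)
    where
    open ≤-Reasoning
    Vs : List (Vertex n)
    Vs = allVertices n
    Vs≢[] : 0 < length Vs
    Vs≢[] = subst (0 <_) (sym (length-allVertices n)) (m^n>0 2 n)
    edgesDense : n * length Vs ≤ 2 * m * ∑ Vs (degree upEdge)
    edgesDense = subst₂ (λ l e → n * l ≤ 2 * m * e) (sym (length-allVertices n)) (numEdges≡∑degree) (<⇒≤ many)

vec-ext : ∀ {m} (u v : Vec A m) → (∀ p → lookup u p ≡ lookup v p) → u ≡ v
vec-ext u v u≗v = trans (sym (Vec.tabulate∘lookup u)) (trans (Vec.tabulate-cong u≗v) (Vec.tabulate∘lookup v))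

-- ψ maps Q_n0 onto the subcube below S spanned by the directions ι, reversing
-- inclusion, so down-stars become up-stars.
module AntipodalEmbedding {n n0 : ℕ} (S : Vertex n) (ι : Fin n0 → Fin n) (ι-injective : Injective _≡_ _≡_ ι) where

  coordinate : Vertex n0 → Fin n → Bool
  coordinate Y p with Fin.any? (λ j → ι j Fin.≟ p)
  ... | yes (j , _) = not (lookup Y j)
  ... | no  _       = lookup S p

  ψ : Vertex n0 → Vertex n
  ψ Y = tabulate (coordinate Y)

  lookup-ψ-ι : ∀ Y j → lookup (ψ Y) (ι j) ≡ not (lookup Y j)
  lookup-ψ-ι Y j rewrite Vec.lookup∘tabulate (coordinate Y) (ι j) with Fin.any? (λ j' → ι j' Fin.≟ ι j)
  ... | yes (j' , ιj'≡ιj) rewrite ι-injective ιj'≡ιj = refl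
  ... | no  ∄j'           = contradiction (j , refl) ∄j'

  lookup-ψ-∉ : ∀ Y p → ¬ (Σ (Fin n0) λ j → ι j ≡ p) → lookup (ψ Y) p ≡ lookup S p
  lookup-ψ-∉ Y p p∉ι rewrite Vec.lookup∘tabulate (coordinate Y) p with Fin.any? (λ j → ι j Fin.≟ p)
  ... | yes p∈ι = contradiction p∈ι p∉ι
  ... | no  _   = refl

  ψ-injective : Injective _≡_ _≡_ ψ
  ψ-injective {Y} {Y'} ψY≡ψY' = vec-ext Y Y' λ j → not-injective (begin
    not (lookup Y j)    ≡⟨ sym (lookup-ψ-ι Y j) ⟩
    lookup (ψ Y) (ι j)  ≡⟨ cong (λ Z → lookup Z (ι j)) ψY≡ψY' ⟩
    lookup (ψ Y') (ι j) ≡⟨ lookup-ψ-ι Y' j ⟩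
    not (lookup Y' j)   ∎)
    where open ≡-Reasoning

  ψ-flipAt : ∀ Y j → ψ (flipAt Y j) ≡ flipAt (ψ Y) (ι j)
  ψ-flipAt Y j = vec-ext _ _ λ p → coordinatewise p (Fin.any? (λ q → ι q Fin.≟ p))
    where
    coordinatewise : ∀ p → Dec (Σ (Fin n0) λ q → ι q ≡ p) → lookup (ψ (flipAt Y j)) p ≡ lookup (flipAt (ψ Y) (ι j)) p
    coordinatewise p (yes (q , refl)) with q Fin.≟ j
    ... | yes refl = begin
      lookup (ψ (flipAt Y q)) (ι q)      ≡⟨ lookup-ψ-ι (flipAt Y q) q ⟩
      not (lookup (flipAt Y q) q)        ≡⟨ cong not (Vec.lookup∘updateAt q Y) ⟩
      not (not (lookup Y q))             ≡⟨ cong not (sym (lookup-ψ-ι Y q)) ⟩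
      not (lookup (ψ Y) (ι q))           ≡⟨ sym (Vec.lookup∘updateAt (ι q) (ψ Y)) ⟩
      lookup (flipAt (ψ Y) (ι q)) (ι q)  ∎
      where open ≡-Reasoning
    ... | no  q≢j  = begin
      lookup (ψ (flipAt Y j)) (ι q)      ≡⟨ lookup-ψ-ι (flipAt Y j) q ⟩
      not (lookup (flipAt Y j) q)        ≡⟨ cong not (Vec.lookup∘updateAt′ q j q≢j Y) ⟩
      not (lookup Y q)                   ≡⟨ sym (lookup-ψ-ι Y q) ⟩
      lookup (ψ Y) (ι q)                 ≡⟨ sym (Vec.lookup∘updateAt′ (ι q) (ι j) (q≢j ∘ ι-injective) (ψ Y)) ⟩
      lookup (flipAt (ψ Y) (ι j)) (ι q)  ∎
      where open ≡-Reasoning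
    coordinatewise p (no p∉ι) = begin
      lookup (ψ (flipAt Y j)) p          ≡⟨ lookup-ψ-∉ (flipAt Y j) p p∉ι ⟩
      lookup S p                         ≡⟨ sym (lookup-ψ-∉ Y p p∉ι) ⟩
      lookup (ψ Y) p                     ≡⟨ sym (Vec.lookup∘updateAt′ p (ι j) (λ p≡ιj → p∉ι (j , sym p≡ιj)) (ψ Y)) ⟩
      lookup (flipAt (ψ Y) (ι j)) p      ∎
      where open ≡-Reasoning

  ψ-reflects-adjacency : ∀ Y Y' → QAdj (ψ Y) (ψ Y') → QAdj Y Y'
  ψ-reflects-adjacency Y Y' (p , ψY'≡) with Fin.any? (λ j → ι j Fin.≟ p)
  ... | yes (j , refl) = j , ψ-injective (trans ψY'≡ (sym (ψ-flipAt Y j)))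
  ... | no  p∉ι        = contradiction (begin
      lookup (ψ Y) p              ≡⟨ lookup-ψ-∉ Y p p∉ι ⟩
      lookup S p                  ≡⟨ sym (lookup-ψ-∉ Y' p p∉ι) ⟩
      lookup (ψ Y') p             ≡⟨ cong (λ Z → lookup Z p) ψY'≡ ⟩
      lookup (flipAt (ψ Y) p) p   ≡⟨ Vec.lookup∘updateAt p (ψ Y) ⟩
      not (lookup (ψ Y) p)        ∎) (not-¬ refl)
    where open ≡-Reasoning

module InducedCopy {n0 k : ℕ} (G : Graph) (A : Vertex n0 → Bool) (kpart : KPartite (suc k) A)
  (φ : Fin (Graph.V G) → Vertex n0) (φ-injective : Injective _≡_ _≡_ φ)
  (φ-vertex : ∀ a → StarVertex A (φ a))
  (φ-edge : ∀ a b → Graph.adj G a b ≡ true → StarEdge A (φ a) (φ b))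
  (φ-induced : ∀ a b → QAdj (φ a) (φ b) → Graph.adj G a b ≡ true)
  {n : ℕ} (H : SubQ n) (S : Vertex n) (box : Box n0 (λ (a : Tuple n (suc k)) → distinct a ∧ StarBelow H S a)) where

  open Box box

  part : Fin n0 → Fin (suc k)
  part = proj₁ kpart

  corner : (Fin (suc k) → Fin n0) → Tuple n (suc k)
  corner s = tabulate λ i → side i (s i)

  lookup-corner : ∀ s i → lookup (corner s) i ≡ side i (s i)
  lookup-corner s i = Vec.lookup∘tabulate (λ i → side i (s i)) i

  corner-distinct : ∀ s → distinct (corner s) ≡ true
  corner-distinct s = ∧-conicalˡ (distinct (corner s)) _ (corner∈D s)

  corner⊆S : ∀ s → setOf (corner s) ⊆ᵇ S ≡ true
  corner⊆S s = ∧-conicalˡ (setOf (corner s) ⊆ᵇ S) _ (∧-conicalʳ (distinct (corner s)) _ (corner∈D s))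

  corner-upStar : ∀ s → allᵇ (upEdge H (S ∖ setOf (corner s))) (corner s) ≡ true
  corner-upStar s = ∧-conicalʳ (setOf (corner s) ⊆ᵇ S) _ (∧-conicalʳ (distinct (corner s)) _ (corner∈D s))

  ι : Fin n0 → Fin n
  ι j = side (part j) j

  -- If part j ≢ part j', then ι j and ι j' are two entries of one corner, a distinct tuple.
  ι-injective : Injective _≡_ _≡_ ι
  ι-injective {j} {j'} ιj≡ιj' with part j Fin.≟ part j'
  ... | yes same  = side-injective (part j') (subst (λ i → side i j ≡ side (part j') j') same ιj≡ιj')
  ... | no  apart = contradiction (distinct⇒lookup-injective (corner s) (corner-distinct s) (begin
      lookup (corner s) (part j)   ≡⟨ lookup-corner s (part j) ⟩
      side (part j) (s (part j))   ≡⟨ cong (side (part j)) (VF.updateAt-updates (part j) (λ _ → j')) ⟩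
      ι j                          ≡⟨ ιj≡ιj' ⟩
      ι j'                         ≡⟨ cong (side (part j')) (sym (VF.updateAt-minimal (part j') (part j) (λ _ → j') (apart ∘ sym))) ⟩
      side (part j') (s (part j')) ≡⟨ sym (lookup-corner s (part j')) ⟩
      lookup (corner s) (part j')  ∎)) apart
    where
    open ≡-Reasoning
    s : Fin (suc k) → Fin n0
    s = VF.updateAt (λ _ → j') (part j) (λ _ → j)

  ι∈S : ∀ j → lookup S (ι j) ≡ true
  ι∈S j = ⊆ᵇ⇒lookup (setOf c) S (corner⊆S (λ _ → j)) (ι j)
            (trans (Vec.lookup∘tabulate _ (ι j)) (subst (λ y → y ∈ᵇ c ≡ true) (lookup-corner _ (part j)) (lookup∈ᵇ c (part j))))
    where
    c : Tuple n (suc k)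
    c = corner (λ _ → j)

  open AntipodalEmbedding S ι ι-injective

  module Star (X : Vertex n0) (AX : A X ≡ true) where

    element : Fin (suc k) → Fin n0
    element i = proj₁ (proj₁ (proj₂ kpart X AX i))

    element∈X : ∀ i → lookup X (element i) ≡ true
    element∈X i = proj₁ (proj₂ (proj₁ (proj₂ kpart X AX i)))

    part-element : ∀ i → part (element i) ≡ i
    part-element i = proj₂ (proj₂ (proj₁ (proj₂ kpart X AX i)))

    element-part : ∀ j → lookup X j ≡ true → element (part j) ≡ j
    element-part j j∈X = proj₂ (proj₂ kpart X AX (part j)) _ j (element∈X (part j)) (part-element (part j)) j∈X refl

    top : Tuple n (suc k)
    top = corner element

    lookup-top : ∀ i → lookup top i ≡ ι (element i)
    lookup-top i = trans (lookup-corner element i) (cong (λ i' → side i' (element i)) (sym (part-element i)))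

    ιj∈ᵇtop≡Xj : ∀ j → ι j ∈ᵇ top ≡ lookup X j
    ιj∈ᵇtop≡Xj j = ⇔→≡ {z = true} (mk⇔
      (λ ιj∈top → let (i , topᵢ≡ιj) = ∈ᵇ⇒∃lookup (ι j) top ιj∈top in
                   subst (λ j' → lookup X j' ≡ true) (ι-injective (trans (sym (lookup-top i)) topᵢ≡ιj)) (element∈X i))
      (λ j∈X → subst (λ y → y ∈ᵇ top ≡ true) (trans (lookup-top (part j)) (cong ι (element-part j j∈X))) (lookup∈ᵇ top (part j))))

    ψX≡S∖top : ψ X ≡ S ∖ setOf top
    ψX≡S∖top = vec-ext _ _ λ p → trans (coordinatewise p (Fin.any? (λ j → ι j Fin.≟ p)))
                                       (sym (trans (lookup-∖ S (setOf top) p) (cong (λ b → lookup S p ∧ not b) (Vec.lookup∘tabulate _ p))))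
      where
      coordinatewise : ∀ p → Dec (Σ (Fin n0) λ j → ι j ≡ p) → lookup (ψ X) p ≡ lookup S p ∧ not (p ∈ᵇ top)
      coordinatewise p (yes (j , refl)) = begin
        lookup (ψ X) (ι j)                  ≡⟨ lookup-ψ-ι X j ⟩
        not (lookup X j)                    ≡⟨ cong not (sym (ιj∈ᵇtop≡Xj j)) ⟩
        not (ι j ∈ᵇ top)                    ≡⟨ cong (_∧ not (ι j ∈ᵇ top)) (sym (ι∈S j)) ⟩
        lookup S (ι j) ∧ not (ι j ∈ᵇ top)   ∎
        where open ≡-Reasoning
      coordinatewise p (no p∉ι) = begin
        lookup (ψ X) p                      ≡⟨ lookup-ψ-∉ X p p∉ι ⟩
        lookup S p                          ≡⟨ sym (∧-identityʳ _) ⟩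
        lookup S p ∧ not false              ≡⟨ cong (λ b → lookup S p ∧ not b) (sym (¬-not p∉top)) ⟩
        lookup S p ∧ not (p ∈ᵇ top)         ∎
        where
        open ≡-Reasoning
        p∉top : p ∈ᵇ top ≢ true
        p∉top p∈top = let (i , topᵢ≡p) = ∈ᵇ⇒∃lookup p top p∈top in p∉ι (element i , trans (sym (lookup-top i)) topᵢ≡p)

    star-edge : ∀ j → lookup X j ≡ true → SubQ.edge H (ψ X) (ψ (flipAt X j)) ≡ true
    star-edge j j∈X = subst₂ (λ u v → SubQ.edge H u v ≡ true)
      (sym ψX≡S∖top) (sym (trans (ψ-flipAt X j) (cong (λ u → flipAt u (ι j)) ψX≡S∖top)))
      (subst (λ y → SubQ.edge H (S ∖ setOf top) (flipAt (S ∖ setOf top) y) ≡ true) ιj≡topₚ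
        (∧-conicalʳ (not (lookup (S ∖ setOf top) (lookup top (part j)))) _
          (allᵇ⇒lookup (upEdge H (S ∖ setOf top)) top (corner-upStar element) (part j))))
      where
      ιj≡topₚ : lookup top (part j) ≡ ι j
      ιj≡topₚ = trans (lookup-top (part j)) (cong ι (element-part j j∈X))

  embedding : Fin (Graph.V G) → Vertex n
  embedding = ψ ∘ φ

  embedding-in-H : ∀ a → SubQ.vert H (embedding a) ≡ true
  embedding-in-H a with φ-vertex a
  ... | inj₁ Aφa = SubQ.edge-vtx H _ _ (star-edge (element zero) (element∈X zero))
    where open Star (φ a) Aφa
  ... | inj₂ (X , j , AX , j∈X , φa≡) =
    SubQ.edge-vtx H _ _ (subst (λ Y → SubQ.edge H (ψ Y) (ψ X) ≡ true) (sym φa≡)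
      (trans (SubQ.edge-sym H _ _) (Star.star-edge X AX j j∈X)))

  embedding-edge : ∀ a b → Graph.adj G a b ≡ true → SubQ.edge H (embedding a) (embedding b) ≡ true
  embedding-edge a b ab with φ-edge a b ab
  ... | X , j , AX , j∈X , inj₁ (φa≡ , φb≡) =
    subst₂ (λ Y Y' → SubQ.edge H (ψ Y) (ψ Y') ≡ true) (sym φa≡) (sym φb≡) (Star.star-edge X AX j j∈X)
  ... | X , j , AX , j∈X , inj₂ (φb≡ , φa≡) =
    subst₂ (λ Y Y' → SubQ.edge H (ψ Y) (ψ Y') ≡ true) (sym φa≡) (sym φb≡)
      (trans (SubQ.edge-sym H _ _) (Star.star-edge X AX j j∈X))

  copy : ContainsInducedCopy G H
  copy = embedding , φ-injective ∘ ψ-injective , embedding-in-H , embedding-edge ,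
         λ a b → φ-induced a b ∘ ψ-reflects-adjacency (φ a) (φ b)

¬QAdj-refl : ∀ {n} (x : Vertex n) → ¬ QAdj x x
¬QAdj-refl x (i , x≡flip) = not-¬ refl (trans (cong (λ y → lookup y i) x≡flip) (Vec.lookup∘updateAt i x))

numEdges>0⇒∃vert : ∀ {n} (H : SubQ n) → 0 < numEdges H → Σ (Vertex n) λ x → SubQ.vert H x ≡ true
numEdges>0⇒∃vert {n} H e>0 with ∑>0⇒∃>0 (allVertices n) (degree (upEdge H)) (subst (0 <_) (numEdges≡∑degree H) e>0)
... | x , deg>0 with ∑>0⇒∃>0 (allFin n) (λ i → ind (upEdge H x i)) deg>0
...   | i , edge>0 = x , SubQ.edge-vtx H x _ (∧-conicalʳ (not (lookup x i)) _ (ind>0 edge>0))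
  where
  ind>0 : ∀ {b} → 0 < ind b → b ≡ true
  ind>0 {true} _ = refl

copy-from-Q₀ : ∀ {n} (G : Graph) (φ : Fin (Graph.V G) → Vertex 0) → Injective _≡_ _≡_ φ →
               (H : SubQ n) → 0 < numEdges H → ContainsInducedCopy G H
copy-from-Q₀ G φ φ-injective H e>0 =
  (λ _ → x) , (λ _ → all-equal _ _) , (λ _ → x∈H) ,
  (λ a b ab → contradiction (trans (sym ab) (subst (λ b → Graph.adj G a b ≡ false) (all-equal a b) (Graph.irrefl G a))) λ ()) ,
  (λ _ _ → ⊥-elim ∘ ¬QAdj-refl x)
  where
  x : Vertex _
  x = proj₁ (numEdges>0⇒∃vert H e>0)
  x∈H : SubQ.vert H x ≡ true
  x∈H = proj₂ (numEdges>0⇒∃vert H e>0)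
  all-equal : ∀ a b → a ≡ b
  all-equal a b with φ a | φ b | φ-injective {a} {b}
  ... | [] | [] | inj = inj refl

bound-unless-copy : ∀ {n} (G : Graph) m (H : SubQ n) → (n * 2 ^ n < 2 * m * numEdges H → ContainsInducedCopy G H) →
                    ¬ ContainsInducedCopy G H → 2 * m * numEdges H ≤ n * 2 ^ n
bound-unless-copy {n} G m H dense⇒copy noCopy with 2 * m * numEdges H ≤? n * 2 ^ n
... | yes bounded  = bounded
... | no  ¬bounded = contradiction (dense⇒copy (≰⇒> ¬bounded)) noCopy

edges-positive : ∀ a m e → a < 2 * m * e → 0 < e
edges-positive a m zero    a<0 = contradiction (subst (a <_) (*-zeroʳ (2 * m)) a<0) λ ()
edges-positive a m (suc e) _   = z<s

theoremA1 : (G : Graph) → HasInducedPartiteRep G →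
    (m : ℕ) → Σ ℕ λ N → (n : ℕ) → N ≤ n → (H : SubQ n) →
      ¬ ContainsInducedCopy G H → 2 * m * numEdges H ≤ n * 2 ^ n
theoremA1 G (zero , suc _ , _ , _ , (part , _) , _) m with part zero
... | ()
theoremA1 G (zero , zero , _ , _ , _ , φ , φ-injective , _) m =
  0 , λ n _ H → bound-unless-copy G m H λ dense → copy-from-Q₀ G φ φ-injective H (edges-positive _ m _ dense)
theoremA1 G (suc k , n0 , A , _ , kpart , φ , φ-injective , φ-vertex , φ-edge , φ-induced) m =
  N , λ n N≤n H → bound-unless-copy G m H (copy n N≤n H)
  where
  M N : ℕ
  M = (2 * m) ^ suc k
  N = proj₁ (dense⇒box (suc k) n0 (2 * M)) ⊔ suc (2 * M * (suc k * suc k))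
  copy : ∀ n → N ≤ n → (H : SubQ n) → n * 2 ^ n < 2 * m * numEdges H → ContainsInducedCopy G H
  copy n N≤n H dense with many-edges⇒dense-stars H k m dense
  ... | S , stars = InducedCopy.copy G A kpart φ φ-injective φ-vertex φ-edge φ-induced H S (Box-shrink
          (proj₂ (dense⇒box (suc k) n0 (2 * M)) n (≤-trans (m≤m⊔n _ _) N≤n) _
            (count-distinct M (StarBelow H S) (≤-trans (m≤n⊔m _ _) N≤n) stars)))
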